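{- Let $f\colon\Gamma\to\Gamma'$ be a finite harmonic morphism of metrised graphs. Then the pullback map $f^*\colon\mathrm{H}_1(\Gamma',\mathbb{R})\to\mathrm{H}_1(\Gamma,\mathbb{R})$, defined as the adjoint of the pushforward with respect to the intersection length pairings, is given by $$f^*\Big(\sum_{e'}\lambda_{e'}\, e'\Big)=\sum_e\lambda_{f(e)}\,d_e(f)\, e,$$ the sums being over unoriented edges of $\Gamma'$, resp. $\Gamma$ (the summands do not depend on the chosen orientations). In particular, $f^*$ restricts to a map $\mathrm{H}_1(\Gamma',\mathbb{Z})\to\mathrm{H}_1(\Gamma,\mathbb{Z})$.
   Context: A graph is $(V(\Gamma),E(\Gamma),\partial_0,e\mapsto e^{ -1})$ with finite sets of vertices and oriented edges, source map $\partial_0$ and a fixed-point-free involution; $\partial_1(e)=\partial_0(e^{ -1})$; $T_v(\Gamma)=\{e:\partial_0(e)=v\}$. A metrised graph assigns each unoriented edge a length $l(e)>0$. A finite morphism $f\colon\Gamma\to\Gamma'$ is a pair of maps on vertices and oriented edges compatible with $\partial_0$ and inversion such that $d_e(f)=l(f(e))/l(e)$ is a positive integer for all $e$. It is harmonic if it is surjective and for every $v\in V(\Gamma)$ the quantity $d_v(f)=\sum_{e\in T_v(\Gamma),\,f(e)=e'}d_e(f)$ is independent of $e'\in T_{f(v)}(\Gamma')$. $\mathrm{C}_1(\Gamma,R)$ is the free $R$-module on oriented edges modulo $e^{ -1}=-e$, $\mathrm{H}_1(\Gamma,R)$ the kernel of $\partial\colon e\mapsto\partial_0(e)-\partial_1(e)$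 to $\bigoplus_v R\,v$. The intersection length pairing is the restriction to $\mathrm{H}_1$ of the symmetric pairing with $\langle e,e\rangle=l(e)$, $\langle e,e^{ -1}\rangle=-l(e)$, $\langle e_1,e_2\rangle=0$ otherwise. The pushforward is $f_*(\sum\lambda_e e)=\sum\lambda_e f(e)$. -}

module Defs where

open import Level using (Level; _⊔_)
open import Data.Nat.Base using (ℕ; zero; suc; _+_; _≥_)
open import Data.Fin.Base using (Fin; zero; suc)
open import Data.Fin.Properties using (_≟_)
open import Data.Bool.Base using (if_then_else_)
open import Data.Product.Base using (Σ; _×_; ∃)
open import Relation.Nullary.Decidable.Core using (⌊_⌋)
open import Relation.Nullary.Negation.Core using (¬_)
open import Relation.Binary.PropositionalEquality.Core using (_≡_)
open import Algebra.Bundles using (CommutativeRing)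
import Algebra.Definitions.RawMonoid as RawMonoidDefs

-- Finite graphs (Serre-style): vertices Fin nV, oriented edges Fin nE,
-- source map ∂₀ and a fixed-point-free involution e ↦ e⁻¹.

record Graph : Set where
  field
    nV      : ℕ
    nE      : ℕ
    ∂₀      : Fin nE → Fin nV
    inv     : Fin nE → Fin nE
    inv-inv : ∀ e → inv (inv e) ≡ e
    inv-fix : ∀ e → ¬ (inv e ≡ e)

  ∂₁ : Fin nE → Fin nV
  ∂₁ e = ∂₀ (inv e)

open Graph public

Vtx : Graph → Set
Vtx Γ = Fin (nV Γ)

Edge : Graph → Set
Edge Γ = Fin (nE Γ)

Σℕ : ∀ {n} → (Fin n → ℕ) → ℕ
Σℕ {zero}  g = 0
Σℕ {suc n} g = g zero + Σℕ (λ i → g (suc i))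

[_≟ᶠ_]ℕ : ∀ {n} → Fin n → Fin n → ℕ → ℕ
[ a ≟ᶠ b ]ℕ k = if ⌊ a ≟ b ⌋ then k else 0

-- Everything involving coefficients / lengths lives in a commutative
-- ring R (ℝ in the paper).

module _ {c ℓ : Level} (R : CommutativeRing c ℓ) where
  open CommutativeRing R
  open RawMonoidDefs +-rawMonoid using (sum) renaming (_×_ to _·ℕ_)

  record Metric (Γ : Graph) : Set (c ⊔ ℓ) where
    field
      len     : Edge Γ → Carrier
      len-inv : ∀ e → len (inv Γ e) ≈ len e
  open Metric public

  -- chains: elements of the free R-module on oriented edges;
  -- C₁(Γ,R) is its quotient by e⁻¹ = -e, i.e. by the relation below.
  Chain : Graph → Set c
  Chain Γ = Edge Γ → Carrier

  ChainEq : (Γ : Graph) → Chain Γ → Chain Γ → Set ℓ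
  ChainEq Γ x z = ∀ (e : Edge Γ) → x e - x (inv Γ e) ≈ z e - z (inv Γ e)

  δ : ∀ {n} → Fin n → Fin n → Carrier
  δ a b = if ⌊ a ≟ b ⌋ then 1# else 0#

  bdry : (Γ : Graph) → Chain Γ → Vtx Γ → Carrier
  bdry Γ x v = sum (λ e → x e * (δ (∂₀ Γ e) v - δ (∂₁ Γ e) v))

  IsCycle : (Γ : Graph) → Chain Γ → Set ℓ
  IsCycle Γ x = ∀ v → bdry Γ x v ≈ 0#

  edgePair : (Γ : Graph) → Metric Γ → Edge Γ → Edge Γ → Carrier
  edgePair Γ m e₁ e₂ =
    if ⌊ e₁ ≟ e₂ ⌋ then len m e₁
    else (if ⌊ inv Γ e₁ ≟ e₂ ⌋ then - len m e₁ else 0#)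

  pairing : (Γ : Graph) → Metric Γ → Chain Γ → Chain Γ → Carrier
  pairing Γ m x y = sum (λ e₁ → sum (λ e₂ → x e₁ * y e₂ * edgePair Γ m e₁ e₂))

  record FiniteMorphism (Γ Γ' : Graph) (m : Metric Γ) (m' : Metric Γ') : Set (c ⊔ ℓ) where
    field
      fV      : Vtx Γ → Vtx Γ'
      fE      : Edge Γ → Edge Γ'
      f-∂₀    : ∀ e → ∂₀ Γ' (fE e) ≡ fV (∂₀ Γ e)
      f-inv   : ∀ e → fE (inv Γ e) ≡ inv Γ' (fE e)
      dE      : Edge Γ → ℕ
      dE-pos  : ∀ e → dE e ≥ 1
      dE-inv  : ∀ e → dE (inv Γ e) ≡ dE e
      dE-len  : ∀ e → len m' (fE e) ≈ dE e ·ℕ len m e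
  open FiniteMorphism public

  localDeg : ∀ {Γ Γ' m m'} → FiniteMorphism Γ Γ' m m' → Vtx Γ → Edge Γ' → ℕ
  localDeg {Γ} φ v e' = Σℕ (λ e → [ ∂₀ Γ e ≟ᶠ v ]ℕ ([ fE φ e ≟ᶠ e' ]ℕ (dE φ e)))

  IsHarmonic : ∀ {Γ Γ' m m'} → FiniteMorphism Γ Γ' m m' → Set
  IsHarmonic {Γ} {Γ'} φ =
    (∀ (v' : Vtx Γ') → ∃ λ v → fV φ v ≡ v') ×
    (∀ (e' : Edge Γ') → ∃ λ e → fE φ e ≡ e') ×
    (∀ (v : Vtx Γ) → ∃ λ (dv : ℕ) →
        ∀ (e' : Edge Γ') → ∂₀ Γ' e' ≡ fV φ v → localDeg φ v e' ≡ dv)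

  push : ∀ {Γ Γ' m m'} → FiniteMorphism Γ Γ' m m' → Chain Γ → Chain Γ'
  push φ y e' = sum (λ e → if ⌊ fE φ e ≟ e' ⌋ then y e else 0#)

  pull : ∀ {Γ Γ' m m'} → FiniteMorphism Γ Γ' m m' → Chain Γ' → Chain Γ
  pull φ x' e = dE φ e ·ℕ x' (fE φ e)

{-# OPTIONS --safe #-}
-- An element of C₁ is determined by its skew coefficients x̂(e) = x(e) - x(e⁻¹), and both
-- the boundary at v and the length pairing only see these: ∂x(v) = Σ_{e ∈ T_v} x̂(e)
-- and ⟨x, y⟩ = Σ_e x(e) l(e) ŷ(e). The formula f^* multiplies the skew coefficient
-- of e by d_e(f). Regrouping the sum over T_v by the fibres of f, harmonicity
-- (Σ_{e ∈ T_v, f(e) = e'} d_e(f) = d_v(f) for e' ∈ T_{f(v)}) gives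
-- ∂(f^* x')(v) = d_v(f) · ∂x'(f(v)), so cycles go to cycles. Regrouping the pairing
-- by fibres and using l(f(e)) = d_e(f) l(e) gives adjointness, for arbitrary chains.
module Submission where

open import Defs
open import Level using (Level)
open import Data.Nat.Base using (ℕ; zero; suc)
import Data.Nat.Base as ℕ
open import Data.Fin.Base using (Fin; zero; suc; punchIn)
open import Data.Fin.Properties using (_≟_; punchInᵢ≢i)
open import Data.Fin.Permutation using (permutation)
open import Data.Bool.Base using (if_then_else_)
open import Data.Product.Base using (_×_; _,_)
open import Data.Empty using (⊥-elim)
open import Function.Base using (_∘_)
open import Relation.Nullary.Decidable using (Dec; ⌊_⌋; yes; no)
open import Relation.Nullary.Negation.Core using (¬_)
open import Relation.Binary.PropositionalEquality as ≡ using (_≡_; _≢_)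
open import Algebra.Bundles using (CommutativeRing)
import Algebra.Definitions.RawMonoid as RawMonoidDefinitions
import Algebra.Properties.Semiring.Sum as SemiringSum
import Algebra.Properties.Semiring.Mult as SemiringMult
import Algebra.Properties.Ring as RingProperties
import Algebra.Properties.CommutativeSemigroup as CommutativeSemigroupProperties
import Relation.Binary.Reasoning.Setoid as SetoidReasoning

Σℕ-zero : ∀ {n} {g : Fin n → ℕ} → (∀ i → g i ≡ 0) → Σℕ g ≡ 0
Σℕ-zero {zero}  g≡0 = ≡.refl
Σℕ-zero {suc n} g≡0 = ≡.cong₂ ℕ._+_ (g≡0 zero) (Σℕ-zero (g≡0 ∘ suc))

module _ {c ℓ : Level} (R : CommutativeRing c ℓ) where
  open CommutativeRing R hiding (zero)
  open RawMonoidDefinitions +-rawMonoid using () renaming (_×_ to _·ℕ_)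
  open SemiringSum semiring
    using (sum; sum-cong-≋; sum-remove; sum-replicate-zero; sum-permute;
           ∑-comm; ∑-distrib-+; *-distribˡ-sum; *-distribʳ-sum)
  open SemiringMult semiring using (×-assoc-*; ×-congʳ; ×-homo-+)
  open RingProperties ring
    using (-0#≈0#; -‿+-comm; -‿distribˡ-*; -‿distribʳ-*; x[y-z]≈xy-xz; [y-z]x≈yx-zx)
  open CommutativeSemigroupProperties *-commutativeSemigroup
    using (x∙yz≈y∙xz; xy∙z≈y∙xz; xy∙z≈x∙zy)
  open SetoidReasoning setoid

  fromℕ : ℕ → Carrier
  fromℕ n = n ·ℕ 1#

  ·ℕ≈fromℕ* : ∀ n x → n ·ℕ x ≈ fromℕ n * x
  ·ℕ≈fromℕ* n x = sym (trans (×-assoc-* n 1# x) (×-congʳ n (*-identityˡ x)))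

  fromℕ-Σℕ : ∀ {n} (g : Fin n → ℕ) → fromℕ (Σℕ g) ≈ sum (fromℕ ∘ g)
  fromℕ-Σℕ {zero}  g = refl
  fromℕ-Σℕ {suc n} g = trans (×-homo-+ 1# (g zero) (Σℕ (g ∘ suc))) (+-congˡ (fromℕ-Σℕ (g ∘ suc)))

  δ-≡ : ∀ {n} {a b : Fin n} → a ≡ b → δ R a b ≡ 1#
  δ-≡ {a = a} {b} a≡b with a ≟ b
  ... | yes _   = ≡.refl
  ... | no a≢b = ⊥-elim (a≢b a≡b)

  δ-≢ : ∀ {n} {a b : Fin n} → a ≢ b → δ R a b ≡ 0#
  δ-≢ {a = a} {b} a≢b with a ≟ b
  ... | yes a≡b = ⊥-elim (a≢b a≡b)
  ... | no _    = ≡.refl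

  if-≟≈δ* : ∀ {n} (a b : Fin n) x → (if ⌊ a ≟ b ⌋ then x else 0#) ≈ δ R a b * x
  if-≟≈δ* a b x with a ≟ b
  ... | yes _ = sym (*-identityˡ x)
  ... | no _  = sym (zeroˡ x)

  fromℕ-[≟ᶠ]ℕ : ∀ {n} (a b : Fin n) k → fromℕ ([ a ≟ᶠ b ]ℕ k) ≈ δ R a b * fromℕ k
  fromℕ-[≟ᶠ]ℕ a b k with a ≟ b
  ... | yes _ = sym (*-identityˡ (fromℕ k))
  ... | no _  = sym (zeroˡ (fromℕ k))

  δ-involution : ∀ {n} (σ : Fin n → Fin n) → (∀ i → σ (σ i) ≡ i) →
                 ∀ a b → δ R a (σ b) ≡ δ R (σ a) b
  δ-involution σ σσ a b with a ≟ σ b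
  ... | yes a≡σb = ≡.sym (δ-≡ (≡.trans (≡.cong σ a≡σb) (σσ b)))
  ... | no a≢σb = ≡.sym (δ-≢ (λ σa≡b → a≢σb (≡.trans (≡.sym (σσ a)) (≡.cong σ σa≡b))))

  sum-neg : ∀ {n} (f : Fin n → Carrier) → sum (λ i → - f i) ≈ - sum f
  sum-neg {zero}  f = sym -0#≈0#
  sum-neg {suc n} f = trans (+-congˡ (sum-neg (f ∘ suc))) (-‿+-comm (f zero) (sum (f ∘ suc)))

  sum-sub : ∀ {n} (f g : Fin n → Carrier) → sum (λ i → f i - g i) ≈ sum f - sum g
  sum-sub f g = trans (∑-distrib-+ f (λ i → - g i)) (+-congˡ (sum-neg g))

  sum-δ : ∀ {n} (a : Fin n) (g : Fin n → Carrier) → sum (λ j → δ R a j * g j) ≈ g a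
  sum-δ {suc n} a g = begin
    sum (λ j → δ R a j * g j)
      ≈⟨ sum-remove {i = a} (λ j → δ R a j * g j) ⟩
    δ R a a * g a + sum (λ j → δ R a (punchIn a j) * g (punchIn a j))
      ≈⟨ +-cong (*-congʳ (reflexive (δ-≡ ≡.refl))) (sum-cong-≋ off-diagonal) ⟩
    1# * g a + sum (λ (_ : Fin n) → 0#)
      ≈⟨ +-cong (*-identityˡ (g a)) (sum-replicate-zero n) ⟩
    g a + 0#
      ≈⟨ +-identityʳ (g a) ⟩
    g a ∎
    where
    off-diagonal : ∀ j → δ R a (punchIn a j) * g (punchIn a j) ≈ 0#
    off-diagonal j = trans (*-congʳ (reflexive (δ-≢ (punchInᵢ≢i a j ∘ ≡.sym)))) (zeroˡ _)

  sum-fibres : ∀ {m n} (f : Fin m → Fin n) (g : Fin m → Fin n → Carrier) →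
               sum (λ i → g i (f i)) ≈ sum (λ j → sum (λ i → δ R (f i) j * g i j))
  sum-fibres f g = trans (sum-cong-≋ (λ i → sym (sum-δ (f i) (g i))))
                         (∑-comm (λ i j → δ R (f i) j * g i j))

  sum-swap-involution : ∀ {n} (σ : Fin n → Fin n) → (∀ i → σ (σ i) ≡ i) →
                        (g : Fin n → Fin n → Carrier) →
                        sum (λ i → g i (σ i)) ≈ sum (λ i → g (σ i) i)
  sum-swap-involution σ σσ g =
    trans (sum-permute (λ i → g i (σ i)) (permutation σ σ σσ σσ))
          (sum-cong-≋ (λ i → reflexive (≡.cong (g (σ i)) (σσ i))))

  skew : (Γ : Graph) → Chain R Γ → Chain R Γ
  skew Γ x e = x e - x (inv Γ e)

  bdry≈sum-skew : (Γ : Graph) (x : Chain R Γ) (v : Vtx Γ) →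
                  bdry R Γ x v ≈ sum (λ e → δ R (∂₀ Γ e) v * skew Γ x e)
  bdry≈sum-skew Γ x v = begin
    sum (λ e → x e * (δ R (∂₀ Γ e) v - δ R (∂₁ Γ e) v))
      ≈⟨ sum-cong-≋ (λ e → x[y-z]≈xy-xz (x e) _ _) ⟩
    sum (λ e → x e * δ R (∂₀ Γ e) v - x e * δ R (∂₀ Γ (inv Γ e)) v)
      ≈⟨ sum-sub {nE Γ} _ _ ⟩
    sum (λ e → x e * δ R (∂₀ Γ e) v) - sum (λ e → x e * δ R (∂₀ Γ (inv Γ e)) v)
      ≈⟨ +-congˡ (-‿cong (sum-swap-involution (inv Γ) (inv-inv Γ) (λ a b → x a * δ R (∂₀ Γ b) v))) ⟩
    sum (λ e → x e * δ R (∂₀ Γ e) v) - sum (λ e → x (inv Γ e) * δ R (∂₀ Γ e) v)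
      ≈⟨ sum-sub {nE Γ} _ _ ⟨
    sum (λ e → x e * δ R (∂₀ Γ e) v - x (inv Γ e) * δ R (∂₀ Γ e) v)
      ≈⟨ sum-cong-≋ (λ e → trans (sym ([y-z]x≈yx-zx _ (x e) _)) (*-comm (skew Γ x e) _)) ⟩
    sum (λ e → δ R (∂₀ Γ e) v * skew Γ x e) ∎

  edgePair-δ : (Γ : Graph) (m : Metric R Γ) (e₁ e₂ : Edge Γ) →
               edgePair R Γ m e₁ e₂ ≈ δ R e₁ e₂ * len m e₁ + δ R (inv Γ e₁) e₂ * - len m e₁
  edgePair-δ Γ m e₁ e₂ with e₁ ≟ e₂
  edgePair-δ Γ m e₁ .e₁ | yes ≡.refl with inv Γ e₁ ≟ e₁
  ... | yes inv-e₁≡e₁ = ⊥-elim (inv-fix Γ e₁ inv-e₁≡e₁)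
  ... | no _          = sym (trans (+-cong (*-identityˡ _) (zeroˡ _)) (+-identityʳ _))
  edgePair-δ Γ m e₁ e₂ | no _ with inv Γ e₁ ≟ e₂
  ... | yes _ = sym (trans (+-cong (zeroˡ _) (*-identityˡ _)) (+-identityˡ _))
  ... | no _  = sym (trans (+-cong (zeroˡ _) (zeroˡ _)) (+-identityˡ 0#))

  sum-edgePair : (Γ : Graph) (m : Metric R Γ) (y : Chain R Γ) (e₁ : Edge Γ) →
                 sum (λ e₂ → edgePair R Γ m e₁ e₂ * y e₂) ≈ len m e₁ * skew Γ y e₁
  sum-edgePair Γ m y e₁ = begin
    sum (λ e₂ → edgePair R Γ m e₁ e₂ * y e₂)
      ≈⟨ sum-cong-≋ (λ e₂ → trans (*-congʳ (edgePair-δ Γ m e₁ e₂))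
                                   (trans (distribʳ _ _ _) (+-cong (*-assoc _ _ _) (*-assoc _ _ _)))) ⟩
    sum (λ e₂ → δ R e₁ e₂ * (l * y e₂) + δ R (inv Γ e₁) e₂ * (- l * y e₂))
      ≈⟨ ∑-distrib-+ {nE Γ} _ _ ⟩
    sum (λ e₂ → δ R e₁ e₂ * (l * y e₂)) + sum (λ e₂ → δ R (inv Γ e₁) e₂ * (- l * y e₂))
      ≈⟨ +-cong (sum-δ e₁ (λ e₂ → l * y e₂)) (sum-δ (inv Γ e₁) (λ e₂ → - l * y e₂)) ⟩
    l * y e₁ + - l * y (inv Γ e₁)
      ≈⟨ +-congˡ (trans (sym (-‿distribˡ-* l _)) (-‿distribʳ-* l _)) ⟩
    l * y e₁ + l * - y (inv Γ e₁)
      ≈⟨ distribˡ l _ _ ⟨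
    l * skew Γ y e₁ ∎
    where
    l : Carrier
    l = len m e₁

  pairing≈sum-skew : (Γ : Graph) (m : Metric R Γ) (x y : Chain R Γ) →
                     pairing R Γ m x y ≈ sum (λ e → x e * (len m e * skew Γ y e))
  pairing≈sum-skew Γ m x y = sum-cong-≋ λ e₁ → begin
    sum (λ e₂ → x e₁ * y e₂ * edgePair R Γ m e₁ e₂)  ≈⟨ sum-cong-≋ {nE Γ} (λ e₂ → xy∙z≈x∙zy (x e₁) _ _) ⟩
    sum (λ e₂ → x e₁ * (edgePair R Γ m e₁ e₂ * y e₂)) ≈⟨ *-distribˡ-sum {nE Γ} (x e₁) _ ⟨
    x e₁ * sum (λ e₂ → edgePair R Γ m e₁ e₂ * y e₂)   ≈⟨ *-congˡ (sum-edgePair Γ m y e₁) ⟩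
    x e₁ * (len m e₁ * skew Γ y e₁)                    ∎

  module _ {Γ Γ' : Graph} {m : Metric R Γ} {m' : Metric R Γ'}
           (φ : FiniteMorphism R Γ Γ' m m') where

    IsLocalDegree : Vtx Γ → ℕ → Set
    IsLocalDegree v dv = ∀ e' → ∂₀ Γ' e' ≡ fV φ v → localDeg R φ v e' ≡ dv

    len-fE : ∀ e → len m' (fE φ e) ≈ fromℕ (dE φ e) * len m e
    len-fE e = trans (dE-len φ e) (·ℕ≈fromℕ* (dE φ e) (len m e))

    skew-pull : ∀ x' e → skew Γ (pull R φ x') e ≈ fromℕ (dE φ e) * skew Γ' x' (fE φ e)
    skew-pull x' e = begin
      dE φ e ·ℕ x' (fE φ e) - dE φ (inv Γ e) ·ℕ x' (fE φ (inv Γ e))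
        ≡⟨ ≡.cong₂ (λ k e' → dE φ e ·ℕ x' (fE φ e) - k ·ℕ x' e') (dE-inv φ e) (f-inv φ e) ⟩
      dE φ e ·ℕ x' (fE φ e) - dE φ e ·ℕ x' (inv Γ' (fE φ e))
        ≈⟨ +-cong (·ℕ≈fromℕ* (dE φ e) _) (-‿cong (·ℕ≈fromℕ* (dE φ e) _)) ⟩
      fromℕ (dE φ e) * x' (fE φ e) - fromℕ (dE φ e) * x' (inv Γ' (fE φ e))
        ≈⟨ x[y-z]≈xy-xz _ _ _ ⟨
      fromℕ (dE φ e) * skew Γ' x' (fE φ e) ∎

    skew-push : ∀ y e' → skew Γ' (push R φ y) e' ≈ sum (λ e → δ R (fE φ e) e' * skew Γ y e)
    skew-push y e' = begin
      push R φ y e' - push R φ y (inv Γ' e')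
        ≈⟨ +-cong (push≈ e') (-‿cong (push≈ (inv Γ' e'))) ⟩
      sum (λ e → δ R (fE φ e) e' * y e) - sum (λ e → δ R (fE φ e) (inv Γ' e') * y e)
        ≈⟨ +-congˡ (-‿cong (sum-cong-≋ (λ e → reflexive (≡.cong (_* y e) (inv-shift e))))) ⟩
      sum (λ e → δ R (fE φ e) e' * y e) - sum (λ e → δ R (fE φ (inv Γ e)) e' * y e)
        ≈⟨ +-congˡ (-‿cong (sum-swap-involution (inv Γ) (inv-inv Γ) (λ a b → δ R (fE φ a) e' * y b))) ⟨
      sum (λ e → δ R (fE φ e) e' * y e) - sum (λ e → δ R (fE φ e) e' * y (inv Γ e))
        ≈⟨ sum-sub {nE Γ} _ _ ⟨
      sum (λ e → δ R (fE φ e) e' * y e - δ R (fE φ e) e' * y (inv Γ e))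
        ≈⟨ sum-cong-≋ {nE Γ} (λ e → x[y-z]≈xy-xz _ _ _) ⟨
      sum (λ e → δ R (fE φ e) e' * skew Γ y e) ∎
      where
      push≈ : ∀ e' → push R φ y e' ≈ sum (λ e → δ R (fE φ e) e' * y e)
      push≈ e' = sum-cong-≋ (λ e → if-≟≈δ* (fE φ e) e' (y e))
      inv-shift : ∀ e → δ R (fE φ e) (inv Γ' e') ≡ δ R (fE φ (inv Γ e)) e'
      inv-shift e = ≡.trans (δ-involution (inv Γ') (inv-inv Γ') (fE φ e) e')
                            (≡.cong (λ a → δ R a e') (≡.sym (f-inv φ e)))

    fromℕ-localDeg : ∀ v e' →
      fromℕ (localDeg R φ v e') ≈ sum (λ e → δ R (∂₀ Γ e) v * (δ R (fE φ e) e' * fromℕ (dE φ e)))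
    fromℕ-localDeg v e' = trans (fromℕ-Σℕ {nE Γ} _) (sum-cong-≋ λ e →
      trans (fromℕ-[≟ᶠ]ℕ (∂₀ Γ e) v _) (*-congˡ (fromℕ-[≟ᶠ]ℕ (fE φ e) e' (dE φ e))))

    localDeg-off-star : ∀ v e' → ¬ (∂₀ Γ' e' ≡ fV φ v) → localDeg R φ v e' ≡ 0
    localDeg-off-star v e' e'∉T = Σℕ-zero (λ e → term≡0 e (∂₀ Γ e ≟ v) (fE φ e ≟ e'))
      where
      term≡0 : ∀ e → (p : Dec (∂₀ Γ e ≡ v)) (q : Dec (fE φ e ≡ e')) →
               (if ⌊ p ⌋ then (if ⌊ q ⌋ then dE φ e else 0) else 0) ≡ 0
      term≡0 e (yes ≡.refl) (yes ≡.refl) = ⊥-elim (e'∉T (f-∂₀ φ e))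
      term≡0 e (yes _)      (no _)       = ≡.refl
      term≡0 e (no _)       _            = ≡.refl

    IsLocalDegree⇒fromℕ-localDeg : ∀ v dv → IsLocalDegree v dv →
      ∀ e' → fromℕ (localDeg R φ v e') ≈ δ R (∂₀ Γ' e') (fV φ v) * fromℕ dv
    IsLocalDegree⇒fromℕ-localDeg v dv dv-local e' with ∂₀ Γ' e' ≟ fV φ v
    ... | yes e'∈T = trans (reflexive (≡.cong fromℕ (dv-local e' e'∈T))) (sym (*-identityˡ (fromℕ dv)))
    ... | no e'∉T  = trans (reflexive (≡.cong fromℕ (localDeg-off-star v e' e'∉T))) (sym (zeroˡ (fromℕ dv)))

    bdry-pull : ∀ x' v dv → IsLocalDegree v dv →
                bdry R Γ (pull R φ x') v ≈ fromℕ dv * bdry R Γ' x' (fV φ v)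
    bdry-pull x' v dv dv-local = begin
      bdry R Γ (pull R φ x') v
        ≈⟨ bdry≈sum-skew Γ (pull R φ x') v ⟩
      sum (λ e → δ R (∂₀ Γ e) v * skew Γ (pull R φ x') e)
        ≈⟨ sum-cong-≋ (λ e → *-congˡ (skew-pull x' e)) ⟩
      sum (λ e → δ R (∂₀ Γ e) v * (d e * X (fE φ e)))
        ≈⟨ sum-fibres (fE φ) (λ e e' → δ R (∂₀ Γ e) v * (d e * X e')) ⟩
      sum (λ e' → sum (λ e → δ R (fE φ e) e' * (δ R (∂₀ Γ e) v * (d e * X e'))))
        ≈⟨ sum-cong-≋ fibre-sum ⟨
      sum (λ e' → fromℕ (localDeg R φ v e') * X e')
        ≈⟨ sum-cong-≋ (λ e' → trans (*-congʳ (IsLocalDegree⇒fromℕ-localDeg v dv dv-local e')) (xy∙z≈y∙xz _ _ _)) ⟩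
      sum (λ e' → fromℕ dv * (δ R (∂₀ Γ' e') (fV φ v) * X e'))
        ≈⟨ *-distribˡ-sum {nE Γ'} (fromℕ dv) _ ⟨
      fromℕ dv * sum (λ e' → δ R (∂₀ Γ' e') (fV φ v) * X e')
        ≈⟨ *-congˡ (bdry≈sum-skew Γ' x' (fV φ v)) ⟨
      fromℕ dv * bdry R Γ' x' (fV φ v) ∎
      where
      d : Edge Γ → Carrier
      d = fromℕ ∘ dE φ
      X : Chain R Γ'
      X = skew Γ' x'
      fibre-sum : ∀ e' → fromℕ (localDeg R φ v e') * X e'
                       ≈ sum (λ e → δ R (fE φ e) e' * (δ R (∂₀ Γ e) v * (d e * X e')))
      fibre-sum e' = begin
        fromℕ (localDeg R φ v e') * X e'
          ≈⟨ *-congʳ (fromℕ-localDeg v e') ⟩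
        sum (λ e → δ R (∂₀ Γ e) v * (δ R (fE φ e) e' * d e)) * X e'
          ≈⟨ *-distribʳ-sum {nE Γ} (X e') _ ⟩
        sum (λ e → δ R (∂₀ Γ e) v * (δ R (fE φ e) e' * d e) * X e')
          ≈⟨ sum-cong-≋ {nE Γ} (λ e → trans (*-assoc _ _ _) (trans (*-congˡ (*-assoc _ _ _)) (x∙yz≈y∙xz _ _ _))) ⟩
        sum (λ e → δ R (fE φ e) e' * (δ R (∂₀ Γ e) v * (d e * X e'))) ∎

    pull-resp-ChainEq : ∀ x' z' → ChainEq R Γ' x' z' → ChainEq R Γ (pull R φ x') (pull R φ z')
    pull-resp-ChainEq x' z' x'~z' e =
      trans (skew-pull x' e) (trans (*-congˡ (x'~z' (fE φ e))) (sym (skew-pull z' e)))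

    pull-IsCycle : IsHarmonic R φ → ∀ x' → IsCycle R Γ' x' → IsCycle R Γ (pull R φ x')
    pull-IsCycle (_ , _ , local-degrees) x' x'-cycle v with local-degrees v
    ... | dv , dv-local =
      trans (bdry-pull x' v dv dv-local) (trans (*-congˡ (x'-cycle (fV φ v))) (zeroʳ (fromℕ dv)))

    pull-adjoint : ∀ x' y → pairing R Γ m (pull R φ x') y ≈ pairing R Γ' m' x' (push R φ y)
    pull-adjoint x' y = begin
      pairing R Γ m (pull R φ x') y
        ≈⟨ pairing≈sum-skew Γ m (pull R φ x') y ⟩
      sum (λ e → pull R φ x' e * (len m e * Y e))
        ≈⟨ sum-cong-≋ pushed-length ⟩
      sum (λ e → x' (fE φ e) * (len m' (fE φ e) * Y e))
        ≈⟨ sum-fibres (fE φ) (λ e e' → x' e' * (len m' e' * Y e)) ⟩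
      sum (λ e' → sum (λ e → δ R (fE φ e) e' * (x' e' * (len m' e' * Y e))))
        ≈⟨ sum-cong-≋ fibre-sum ⟩
      sum (λ e' → x' e' * (len m' e' * skew Γ' (push R φ y) e'))
        ≈⟨ pairing≈sum-skew Γ' m' x' (push R φ y) ⟨
      pairing R Γ' m' x' (push R φ y) ∎
      where
      Y : Chain R Γ
      Y = skew Γ y
      pushed-length : ∀ e → pull R φ x' e * (len m e * Y e) ≈ x' (fE φ e) * (len m' (fE φ e) * Y e)
      pushed-length e = begin
        dE φ e ·ℕ x' (fE φ e) * (len m e * Y e)         ≈⟨ *-congʳ (·ℕ≈fromℕ* (dE φ e) _) ⟩
        fromℕ (dE φ e) * x' (fE φ e) * (len m e * Y e)  ≈⟨ xy∙z≈y∙xz _ _ _ ⟩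
        x' (fE φ e) * (fromℕ (dE φ e) * (len m e * Y e)) ≈⟨ *-congˡ (*-assoc _ _ _) ⟨
        x' (fE φ e) * (fromℕ (dE φ e) * len m e * Y e)  ≈⟨ *-congˡ (*-congʳ (len-fE e)) ⟨
        x' (fE φ e) * (len m' (fE φ e) * Y e)           ∎
      fibre-sum : ∀ e' → sum (λ e → δ R (fE φ e) e' * (x' e' * (len m' e' * Y e)))
                       ≈ x' e' * (len m' e' * skew Γ' (push R φ y) e')
      fibre-sum e' = begin
        sum (λ e → δ R (fE φ e) e' * (x' e' * (len m' e' * Y e)))
          ≈⟨ sum-cong-≋ {nE Γ} (λ e → trans (x∙yz≈y∙xz _ _ _) (*-congˡ (x∙yz≈y∙xz _ _ _))) ⟩
        sum (λ e → x' e' * (len m' e' * (δ R (fE φ e) e' * Y e)))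
          ≈⟨ *-distribˡ-sum {nE Γ} (x' e') _ ⟨
        x' e' * sum (λ e → len m' e' * (δ R (fE φ e) e' * Y e))
          ≈⟨ *-congˡ (*-distribˡ-sum {nE Γ} (len m' e') _) ⟨
        x' e' * (len m' e' * sum (λ e → δ R (fE φ e) e' * Y e))
          ≈⟨ *-congˡ (*-congˡ (skew-push y e')) ⟨
        x' e' * (len m' e' * skew Γ' (push R φ y) e') ∎

proposition3p1 : ∀ {c ℓ : Level} (R : CommutativeRing c ℓ)
    (Γ Γ' : Graph) (m : Metric R Γ) (m' : Metric R Γ')
    (φ : FiniteMorphism R Γ Γ' m m') → IsHarmonic R φ →
    -- the formula is well defined on C₁ (independent of orientations)
    (∀ (x' z' : Chain R Γ') → ChainEq R Γ' x' z' →
        ChainEq R Γ (pull R φ x') (pull R φ z')) ×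
    -- it maps H₁(Γ',R) into H₁(Γ,R)
    (∀ (x' : Chain R Γ') → IsCycle R Γ' x' → IsCycle R Γ (pull R φ x')) ×
    -- and it is adjoint to f_* for the intersection length pairings
    (∀ (x' : Chain R Γ') (y : Chain R Γ) → IsCycle R Γ' x' → IsCycle R Γ y →
        CommutativeRing._≈_ R (pairing R Γ m (pull R φ x') y)
                              (pairing R Γ' m' x' (push R φ y)))
proposition3p1 R Γ Γ' m m' φ harmonic =
  pull-resp-ChainEq R φ ,
  pull-IsCycle R φ harmonic ,
  λ x' y _ _ → pull-adjoint R φ x' y
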